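{- Let $\Gamma$ be a set of formulas such that $T=\mathrm{DL}\oplus_{\mathrm{JL}}\mathrm{LP}+\Gamma$ is consistent, and suppose $T\vdash s:C$ for a positive justification term $s$ and $T\vdash t:E$ for a negative justification term $t$. Then there is no positive justification term $j$ such that $T\vdash j:(C\to E)$.
   Context: Justification constants and variables carry a sign: $c_i^\sigma, x_i^\sigma$ with $\sigma\in\{+,-\}$. Terms of sign $\sigma$: $t^\sigma ::= c_i^\sigma\mid x_j^\sigma\mid[t^\sigma+t^\sigma]\mid[t^\sigma\cdot t^\sigma]$, additionally $[t^-\otimes t^-]$ is a negative term and $!t^+$ is a positive term. Formulas: $A::=\bot\mid A_i\mid (A\wedge A)\mid(A\vee A)\mid(A\to A)\mid\lnot A\mid t^+:A\mid t^-:A$. The system $\mathrm{DL}\oplus_{\mathrm{JL}}\mathrm{LP}$ has axioms: classical propositional axioms; Application $s^\sigma:(P\to Q)\to(t^\sigma:P\to[s^\sigma\cdot t^\sigma]:Q)$; Sum $s^\sigma:P\to[s^\sigma+t^\sigma]:P$, $t^\sigma:P\to[s^\sigma+t^\sigma]:P$ (same sign); Denial $s^-:P\to\lnot P$; Pairing $(s^-:P\wedge t^-:Q)\to[s^-\otimes t^-]:(P\wedge Q)$; Positive Factivity $t^+:P\to P$; Positive Introspection $t^+:P\to\,!t^+:(t^+:P)$; rule modus ponens. $\mathrm{DL}\oplus_{\mathrm{JL}}\mathrm{LP}+\Gamma$ denotes the system with the formulas of $\Gamma$ added as axioms. -}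

module Defs where

open import Data.Nat using (ℕ)
open import Data.Bool using (Bool; true; false; _∧_; _∨_; not)
open import Relation.Binary.PropositionalEquality using (_≡_)
open import Relation.Nullary using (¬_)

data Sign : Set where
  pos neg : Sign

data Tm : Sign → Set where
  con  : ∀ {σ} → ℕ → Tm σ
  var  : ∀ {σ} → ℕ → Tm σ
  _⊕_  : ∀ {σ} → Tm σ → Tm σ → Tm σ
  _·_  : ∀ {σ} → Tm σ → Tm σ → Tm σ
  _⊗_  : Tm neg → Tm neg → Tm neg
  !_   : Tm pos → Tm pos

infixr 20 _⇒_
infix 25 _∶_

data Fm : Set where
  ⊥'   : Fm
  atom : ℕ → Fm
  _∧'_ : Fm → Fm → Fm
  _∨'_ : Fm → Fm → Fm
  _⇒_  : Fm → Fm → Fm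
  ¬'_  : Fm → Fm
  _∶_  : ∀ {σ} → Tm σ → Fm → Fm

-- Classical propositional evaluation: atoms and justification formulas
-- are treated as propositional variables via the valuation v.
eval : (Fm → Bool) → Fm → Bool
eval v ⊥' = false
eval v (atom i) = v (atom i)
eval v (A ∧' B) = eval v A ∧ eval v B
eval v (A ∨' B) = eval v A ∨ eval v B
eval v (A ⇒ B) = not (eval v A) ∨ eval v B
eval v (¬' A) = not (eval v A)
eval v (t ∶ A) = v (t ∶ A)

Tautology : Fm → Set
Tautology A = ∀ (v : Fm → Bool) → eval v A ≡ true

-- Derivability in DL ⊕_JL LP + Γ  (Γ a set of formulas, as a predicate)
data _⊢_ (Γ : Fm → Set) : Fm → Set where
  taut   : ∀ {A} → Tautology A → Γ ⊢ A
  app    : ∀ {σ} (s t : Tm σ) (P Q : Fm) →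
           Γ ⊢ ((s ∶ (P ⇒ Q)) ⇒ ((t ∶ P) ⇒ ((s · t) ∶ Q)))
  sumˡ   : ∀ {σ} (s t : Tm σ) (P : Fm) → Γ ⊢ ((s ∶ P) ⇒ ((s ⊕ t) ∶ P))
  sumʳ   : ∀ {σ} (s t : Tm σ) (P : Fm) → Γ ⊢ ((t ∶ P) ⇒ ((s ⊕ t) ∶ P))
  denial : (s : Tm neg) (P : Fm) → Γ ⊢ ((s ∶ P) ⇒ (¬' P))
  pairing : (s t : Tm neg) (P Q : Fm) →
           Γ ⊢ (((s ∶ P) ∧' (t ∶ Q)) ⇒ ((s ⊗ t) ∶ (P ∧' Q)))
  factivity : (t : Tm pos) (P : Fm) → Γ ⊢ ((t ∶ P) ⇒ P)
  introspection : (t : Tm pos) (P : Fm) → Γ ⊢ ((t ∶ P) ⇒ ((! t) ∶ (t ∶ P)))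
  hyp    : ∀ {A} → Γ A → Γ ⊢ A
  mp     : ∀ {A B} → Γ ⊢ (A ⇒ B) → Γ ⊢ A → Γ ⊢ B

Consistent : (Fm → Set) → Set
Consistent Γ = ¬ (Γ ⊢ ⊥')

module Submission where

open import Defs
open import Data.Product using (Σ; _,_)
open import Data.Bool using (true; false)
open import Relation.Nullary using (¬_)
open import Relation.Binary.PropositionalEquality using (refl)

noncontradiction : (A : Fm) → Tautology (A ⇒ ((¬' A) ⇒ ⊥'))
noncontradiction A v with eval v A
... | true  = refl
... | false = refl

module _ {Γ : Fm → Set} where

  ⊢-explosion : ∀ {A} → Γ ⊢ A → Γ ⊢ (¬' A) → Γ ⊢ ⊥'
  ⊢-explosion {A} ⊢A ⊢¬A = mp (mp (taut (noncontradiction A)) ⊢A) ⊢¬A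

  ⊢-factive : ∀ {A} (t : Tm pos) → Γ ⊢ (t ∶ A) → Γ ⊢ A
  ⊢-factive {A} t = mp (factivity t A)

  ⊢-denied : ∀ {A} (t : Tm neg) → Γ ⊢ (t ∶ A) → Γ ⊢ (¬' A)
  ⊢-denied {A} t = mp (denial t A)

proposition5p1 : (Γ : Fm → Set) → Consistent Γ →
    (C E : Fm) (s : Tm pos) (t : Tm neg) →
    Γ ⊢ (s ∶ C) → Γ ⊢ (t ∶ E) →
    ¬ (Σ (Tm pos) (λ j → Γ ⊢ (j ∶ (C ⇒ E))))
proposition5p1 Γ consistent C E s t ⊢s∶C ⊢t∶E (j , ⊢j∶C⇒E) =
  consistent (⊢-explosion ⊢E (⊢-denied t ⊢t∶E))
  where
    ⊢E : Γ ⊢ E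
    ⊢E = mp (⊢-factive j ⊢j∶C⇒E) (⊢-factive s ⊢s∶C)
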